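{- Let $G$ and $H$ be finite graphs and let $D$ be a dominating set of $G\Box H$. If there is a dominating set $S$ of $G$ such that for every $h\in V(H)$ we have $S\in M_G(p_G(D\cap G_h))$, then $|D|\geq \gamma(G)\gamma(H)$.
   Context: $\gamma(X)$ denotes the domination number of a graph $X$ (the minimum size of a dominating set). $G\Box H$ is the Cartesian product of $G$ and $H$. For $h\in V(H)$, $G_h=\{(g,h)\mid g\in V(G)\}$ is the $G$-layer at $h$. The projection $p_G:V(G\Box H)\to V(G)$ is $p_G(g,h)=g$. For $X\subseteq V(G)$, a minimal dominating set of $G$ containing $X$ is a dominating set $S$ of $G$ with $X\subseteq S$ such that no set $S'$ with $X\subseteq S'\subsetneq S$ is a dominating set of $G$; $M_G(X)$ denotes the set of all minimal dominating sets of $G$ containing $X$. -}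

module Defs where

open import Data.Nat using (ℕ; _*_; _≤_)
open import Data.Fin using (Fin; combine)
open import Data.Fin.Subset using (Subset; _∈_; _⊆_; _⊂_; ∣_∣)
open import Data.Vec using (tabulate; lookup)
open import Data.Product using (Σ; ∃; _×_; _,_)
open import Data.Sum using (_⊎_)
open import Relation.Binary.PropositionalEquality using (_≡_)
open import Relation.Nullary using (¬_)

record Graph : Set₁ where
  field
    n      : ℕ
    Adj    : Fin n → Fin n → Set
    sym    : ∀ {u v} → Adj u v → Adj v u
    irrefl : ∀ {u} → ¬ Adj u u
open Graph public

V : Graph → Set
V G = Fin (n G)

Dominating : (G : Graph) → Subset (n G) → Set
Dominating G S = ∀ v → v ∈ S ⊎ Σ (V G) λ u → u ∈ S × Adj G u v

IsDominationNumber : Graph → ℕ → Set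
IsDominationNumber G k =
  (Σ (Subset (n G)) λ S → Dominating G S × ∣ S ∣ ≡ k)
  × (∀ S → Dominating G S → k ≤ ∣ S ∣)

-- Vertex sets of G □ H are subsets of Fin (n G * n H); the vertex (g , h)
-- is encoded as  combine g h  (a bijection Fin a × Fin b ≃ Fin (a * b)).
_∈□_ : ∀ {G H : Graph} → V G × V H → Subset (n G * n H) → Set
(g , h) ∈□ D = combine g h ∈ D

Adj□ : (G H : Graph) → V G × V H → V G × V H → Set
Adj□ G H (g , h) (g' , h') = (g ≡ g' × Adj H h h') ⊎ (Adj G g g' × h ≡ h')

Dominating□ : (G H : Graph) → Subset (n G * n H) → Set
Dominating□ G H D = ∀ (x : V G × V H) →
  _∈□_ {G} {H} x D ⊎ Σ (V G × V H) λ y → _∈□_ {G} {H} y D × Adj□ G H y x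

projLayer : (G H : Graph) → Subset (n G * n H) → V H → Subset (n G)
projLayer G H D h = tabulate λ g → lookup D (combine g h)

MinDomContaining : (G : Graph) → Subset (n G) → Subset (n G) → Set
MinDomContaining G X S =
  Dominating G S × X ⊆ S × (∀ S' → X ⊆ S' → S' ⊂ S → ¬ Dominating G S')

-- For each s ∈ S the row {h ∣ (s , h) ∈ D} dominates H.  Indeed, if some h
-- were not dominated by that row, then (s , h) ∉ D, so p_G(D ∩ G_h) ⊆ S - s,
-- and S - s would still dominate G: the vertices that needed s are dominated
-- in G □ H through the layer G_h, whose projection lies in S - s.  This
-- contradicts the minimality of S.  Hence |D| ≥ Σ_{s ∈ S} |row s| ≥ |S| γ(H)
-- ≥ γ(G) γ(H).
module Submission where

open import Defs hiding (sym)
open import Data.Nat using (zero; suc; _*_; _+_; _≤_; _≤?_; z≤n)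
open import Data.Nat.Properties using (+-mono-≤; m≤n+m; *-monoˡ-≤; module ≤-Reasoning)
open import Data.Fin using (Fin; zero; suc; combine; _≟_)
open import Data.Fin.Properties using (∀-cons)
open import Data.Fin.Subset using (Subset; ∣_∣; _∈_; _∉_; _⊆_; _-_; inside; outside)
open import Data.Fin.Subset.Properties using (x∈p∧x≢y⇒x∈p-y; x∈p⇒p-x⊂p)
open import Data.Product using (Σ; _×_; _,_; proj₁; proj₂)
open import Data.Sum using (_⊎_; inj₁; inj₂)
open import Data.Vec using (Vec; []; _∷_; _++_; concat; group; lookup; here; there)
open import Data.Vec.Properties using ([]=⇒lookup; lookup⇒[]=; lookup∘tabulate; lookup-concat)
open import Relation.Binary.PropositionalEquality using (_≡_; _≢_; refl; sym; trans; cong; module ≡-Reasoning)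
open import Function using (_∘_)
open import Relation.Nullary using (¬_; yes; no; contradiction)
open import Relation.Nullary.Negation using (¬¬-map)
open import Relation.Nullary.Decidable using (decidable-stable)

∣p++q∣≡∣p∣+∣q∣ : ∀ {m k} (p : Subset m) (q : Subset k) → ∣ p ++ q ∣ ≡ ∣ p ∣ + ∣ q ∣
∣p++q∣≡∣p∣+∣q∣ []            q = refl
∣p++q∣≡∣p∣+∣q∣ (inside ∷ p)  q = cong suc (∣p++q∣≡∣p∣+∣q∣ p q)
∣p++q∣≡∣p∣+∣q∣ (outside ∷ p) q = ∣p++q∣≡∣p∣+∣q∣ p q

∣p∣*c≤∣concat∣ : ∀ {m k c} (p : Subset m) (xss : Vec (Subset k) m) →
  (∀ {i} → i ∈ p → c ≤ ∣ lookup xss i ∣) → ∣ p ∣ * c ≤ ∣ concat xss ∣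
∣p∣*c≤∣concat∣ []            []         _     = z≤n
∣p∣*c≤∣concat∣ (inside ∷ p)  (xs ∷ xss) bound = begin
  _ + ∣ p ∣ * _             ≤⟨ +-mono-≤ (bound here) (∣p∣*c≤∣concat∣ p xss (bound ∘ there)) ⟩
  ∣ xs ∣ + ∣ concat xss ∣   ≡⟨ ∣p++q∣≡∣p∣+∣q∣ xs (concat xss) ⟨
  ∣ xs ++ concat xss ∣      ∎
  where open ≤-Reasoning
∣p∣*c≤∣concat∣ (outside ∷ p) (xs ∷ xss) bound = begin
  ∣ p ∣ * _                 ≤⟨ ∣p∣*c≤∣concat∣ p xss (bound ∘ there) ⟩
  ∣ concat xss ∣            ≤⟨ m≤n+m _ ∣ xs ∣ ⟩
  ∣ xs ∣ + ∣ concat xss ∣   ≡⟨ ∣p++q∣≡∣p∣+∣q∣ xs (concat xss) ⟨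
  ∣ xs ++ concat xss ∣      ∎
  where open ≤-Reasoning

rows : ∀ m k → Subset (m * k) → Vec (Subset k) m
rows m k D = proj₁ (group m k D)

concat-rows : ∀ m k (D : Subset (m * k)) → concat (rows m k D) ≡ D
concat-rows m k D = sym (proj₂ (group m k D))

combine∈⇒∈rows : ∀ m k {i : Fin m} {j : Fin k} (D : Subset (m * k)) →
  combine i j ∈ D → j ∈ lookup (rows m k D) i
combine∈⇒∈rows m k {i} {j} D ij∈D = lookup⇒[]= j _ (begin
  lookup (lookup (rows m k D) i) j            ≡⟨ lookup-concat (rows m k D) i j ⟨
  lookup (concat (rows m k D)) (combine i j)  ≡⟨ cong (λ xs → lookup xs (combine i j)) (concat-rows m k D) ⟩
  lookup D (combine i j)                      ≡⟨ []=⇒lookup ij∈D ⟩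
  inside                                      ∎)
  where open ≡-Reasoning

module _ (G H : Graph) {D : Subset (n G * n H)} {g : V G} {h : V H} where

  combine∈⇒∈projLayer : combine g h ∈ D → g ∈ projLayer G H D h
  combine∈⇒∈projLayer gh∈D = lookup⇒[]= g _ (trans (lookup∘tabulate _ g) ([]=⇒lookup gh∈D))

  ∈projLayer⇒combine∈ : g ∈ projLayer G H D h → combine g h ∈ D
  ∈projLayer⇒combine∈ g∈X = lookup⇒[]= _ D (trans (sym (lookup∘tabulate _ g)) ([]=⇒lookup g∈X))

Adj⇒≢ : ∀ (G : Graph) {u v} → Adj G u v → u ≢ v
Adj⇒≢ G uv refl = irrefl G uv

¬¬-∀-Fin : ∀ {m} {P : Fin m → Set} → (∀ i → ¬ ¬ P i) → ¬ ¬ (∀ i → P i)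
¬¬-∀-Fin {zero}  ¬¬P ¬∀P = ¬∀P λ ()
¬¬-∀-Fin {suc m} ¬¬P ¬∀P =
  ¬¬P zero λ P0 → ¬¬-∀-Fin (¬¬P ∘ suc) λ P∘suc → ¬∀P (∀-cons P0 P∘suc)

DominatedBy : (G : Graph) → Subset (n G) → V G → Set
DominatedBy G S v = v ∈ S ⊎ Σ (V G) λ u → u ∈ S × Adj G u v

module RowsDominate (G H : Graph) (D : Subset (n G * n H)) (domD : Dominating□ G H D)
  (S : Subset (n G)) (domS : Dominating G S)
  (minS : ∀ h → MinDomContaining G (projLayer G H D h) S) where

  row : V G → Subset (n H)
  row s = lookup (rows (n G) (n H) D) s

  combine∈⇒∈row : ∀ {s h} → combine s h ∈ D → h ∈ row s
  combine∈⇒∈row = combine∈⇒∈rows (n G) (n H) D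

  combine∈⇒∈S-s : ∀ {g h s} → combine g h ∈ D → g ≢ s → g ∈ S - s
  combine∈⇒∈S-s {h = h} gh∈D =
    x∈p∧x≢y⇒x∈p-y (proj₁ (proj₂ (minS h)) (combine∈⇒∈projLayer G H gh∈D))

  module _ {s : V G} {h : V H} (undominated : ¬ DominatedBy H (row s) h) where

    sh∉D : combine s h ∉ D
    sh∉D = undominated ∘ inj₁ ∘ combine∈⇒∈row

    s-dominated : DominatedBy G (S - s) s
    s-dominated with domD (s , h)
    ... | inj₁ sh∈D = contradiction sh∈D sh∉D
    ... | inj₂ ((_ , h') , sh'∈D , inj₁ (refl , h'~h)) =
      contradiction (inj₂ (h' , combine∈⇒∈row sh'∈D , h'~h)) undominated
    ... | inj₂ ((g , _) , gh∈D , inj₂ (g~s , refl)) =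
      inj₂ (g , combine∈⇒∈S-s gh∈D (Adj⇒≢ G g~s) , g~s)

    neighbour-dominated : ∀ {v} → Adj G s v → DominatedBy G (S - s) v
    neighbour-dominated {v} s~v with domD (v , h)
    ... | inj₁ vh∈D = inj₁ (combine∈⇒∈S-s vh∈D (Adj⇒≢ G s~v ∘ sym))
    ... | inj₂ (_ , vh'∈D , inj₁ (refl , _)) =
      inj₁ (combine∈⇒∈S-s vh'∈D (Adj⇒≢ G s~v ∘ sym))
    ... | inj₂ ((g , _) , gh∈D , inj₂ (g~v , refl)) with g ≟ s
    ...   | yes refl = contradiction gh∈D sh∉D
    ...   | no g≢s   = inj₂ (g , combine∈⇒∈S-s gh∈D g≢s , g~v)

    S-s-dominating : Dominating G (S - s)
    S-s-dominating v with domS v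
    ... | inj₁ v∈S with v ≟ s
    ...   | yes refl = s-dominated
    ...   | no v≢s   = inj₁ (x∈p∧x≢y⇒x∈p-y v∈S v≢s)
    S-s-dominating v | inj₂ (u , u∈S , u~v) with u ≟ s
    ...   | yes refl = neighbour-dominated u~v
    ...   | no u≢s   = inj₂ (u , x∈p∧x≢y⇒x∈p-y u∈S u≢s , u~v)

    projLayer⊆S-s : projLayer G H D h ⊆ S - s
    projLayer⊆S-s g∈X = combine∈⇒∈S-s gh∈D λ { refl → sh∉D gh∈D }
      where gh∈D = ∈projLayer⇒combine∈ G H g∈X

  -- Adjacency is not decidable, so domination can only be obtained up to double
  -- negation; this suffices because the bound γ(H) ≤ |row s| it yields is decidable.
  row-dominating : ∀ {s} → s ∈ S → ¬ ¬ Dominating H (row s)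
  row-dominating {s} s∈S = ¬¬-∀-Fin λ h undominated →
    proj₂ (proj₂ (minS h)) (S - s) (projLayer⊆S-s undominated) (x∈p⇒p-x⊂p s∈S)
      (S-s-dominating undominated)

theorem1 : (G H : Graph) (D : Subset (n G * n H)) → Dominating□ G H D →
    (Σ (Subset (n G)) λ S → Dominating G S ×
      (∀ h → MinDomContaining G (projLayer G H D h) S)) →
    ∀ γG γH → IsDominationNumber G γG → IsDominationNumber H γH →
    γG * γH ≤ ∣ D ∣
theorem1 G H D domD (S , domS , minS) γG γH (_ , γG-min) (_ , γH-min) = begin
  γG * γH                          ≤⟨ *-monoˡ-≤ γH (γG-min S domS) ⟩
  ∣ S ∣ * γH                       ≤⟨ ∣p∣*c≤∣concat∣ S (rows (n G) (n H) D) γH≤∣row∣ ⟩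
  ∣ concat (rows (n G) (n H) D) ∣  ≡⟨ cong ∣_∣ (concat-rows (n G) (n H) D) ⟩
  ∣ D ∣                            ∎
  where
  open ≤-Reasoning
  open RowsDominate G H D domD S domS minS
  γH≤∣row∣ : ∀ {s} → s ∈ S → γH ≤ ∣ row s ∣
  γH≤∣row∣ s∈S = decidable-stable (γH ≤? _) (¬¬-map (γH-min _) (row-dominating s∈S))
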